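{- Let $K$ be a field of characteristic not $2$. For every $n\in\{0,1,2,\dots\}\cup\{\infty\}$, $S_K^{\mathrm{adv}_n}=\{(a,ka):a\in K^\times,\ k\in T_K^{\mathrm{adv}_n}\}$ and $S_K^{\mathrm{back}_n}=\{(a,ka):a\in K^\times,\ k\in T_K^{\mathrm{back}_n}\}$. In particular, if $K=\mathbb{F}_q$ is a finite field of odd order $q$, then $\left|S_{\mathbb{F}_q}^{\mathrm{adv}_\infty}\right|=(q-1)\left|T_{\mathbb{F}_q}^{\mathrm{adv}_\infty}\right|$.
   Context: $S_K=\{(\alpha,\beta)\in K^2:\alpha,\beta,\alpha+\beta,\alpha-\beta\neq 0\}$. For $(\alpha,\beta),(\gamma,\delta)\in S_K$ write $(\alpha,\beta)\mapsto(\gamma,\delta)$ if $2\gamma=\alpha+\beta$ and $\delta^2=\alpha\beta$. For $n\ge0$, $S_K^{\mathrm{adv}_n}$ (resp. $S_K^{\mathrm{back}_n}$) is the set of $x_0\in S_K$ admitting $x_1,\dots,x_n\in S_K$ with $x_0\mapsto\cdots\mapsto x_n$ (resp. $x_{ -1},\dots,x_{ -n}\in S_K$ with $x_{ -n}\mapsto\cdots\mapsto x_0$); the $\infty$ versions are the intersections over all $n$. Let $T_K=K\setminus\{0,1,-1\}$; for $k_1,k_2\in T_K$ write $k_1\overset{k}{\mapsto}k_2$ if $(1+k_1)^2k_2^2=4k_1$. For $n\ge0$, $T_K^{\mathrm{adv}_n}$ (resp. $T_K^{\mathrm{back}_n}$) is the set of $k_0\in T_K$ admitting $k_1,\dots,k_n\in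 T_K$ with $k_0\overset{k}{\mapsto}\cdots\overset{k}{\mapsto}k_n$ (resp. $k_{ -1},\dots,k_{ -n}\in T_K$ with $k_{ -n}\overset{k}{\mapsto}\cdots\overset{k}{\mapsto}k_0$), and $T_K^{\mathrm{adv}_\infty}$, $T_K^{\mathrm{back}_\infty}$ are the intersections over all $n$. -}

module Defs where

open import Level using (Level; _⊔_)
open import Data.Nat using (ℕ; zero; suc)
open import Data.Fin using (Fin)
open import Data.Product using (Σ; ∃; _×_; _,_; proj₁)
open import Relation.Nullary using (¬_)
open import Relation.Binary.PropositionalEquality using (_≡_)
open import Relation.Binary.Bundles using (Setoid)
open import Algebra.Bundles using (CommutativeRing)

record Field (c ℓ : Level) : Set (Level.suc (c ⊔ ℓ)) where
  field
    commutativeRing : CommutativeRing c ℓ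
  open CommutativeRing commutativeRing public
  field
    0≉1     : ¬ (0# ≈ 1#)
    inverse : ∀ x → ¬ (x ≈ 0#) → ∃ λ y → x * y ≈ 1#

HasCard : ∀ {a ℓ p} (A : Setoid a ℓ) → (Setoid.Carrier A → Set p) → ℕ → Set (a ⊔ ℓ ⊔ p)
HasCard A P m =
  Σ (Fin m → Carrier) λ f →
    (∀ i → P (f i)) ×
    (∀ i j → f i ≈ f j → i ≡ j) ×
    (∀ x → P x → ∃ λ i → f i ≈ x)
  where open Setoid A

module FieldDefs {c ℓ} (K : Field c ℓ) where
  open Field K public

  CharNot2 : Set ℓ
  CharNot2 = ¬ (1# + 1# ≈ 0#)

  InS : Carrier → Carrier → Set ℓ
  InS α β = ¬ (α ≈ 0#) × ¬ (β ≈ 0#) × ¬ (α + β ≈ 0#) × ¬ (α - β ≈ 0#)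

  _↦_ : Carrier × Carrier → Carrier × Carrier → Set ℓ
  (α , β) ↦ (γ , δ) =
    InS α β × InS γ δ × ((1# + 1#) * γ ≈ α + β) × (δ * δ ≈ α * β)

  SAdv : ℕ → Carrier × Carrier → Set (c ⊔ ℓ)
  SAdv zero    (α , β) = Level.Lift c (InS α β)
  SAdv (suc n) (α , β) = InS α β × ∃ λ y → ((α , β) ↦ y) × SAdv n y

  SBack : ℕ → Carrier × Carrier → Set (c ⊔ ℓ)
  SBack zero    (α , β) = Level.Lift c (InS α β)
  SBack (suc n) (α , β) = InS α β × ∃ λ y → (y ↦ (α , β)) × SBack n y

  SAdv∞ : Carrier × Carrier → Set (c ⊔ ℓ)
  SAdv∞ x = ∀ n → SAdv n x

  SBack∞ : Carrier × Carrier → Set (c ⊔ ℓ)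
  SBack∞ x = ∀ n → SBack n x

  InT : Carrier → Set ℓ
  InT k = ¬ (k ≈ 0#) × ¬ (k ≈ 1#) × ¬ (k ≈ - 1#)

  _↦ₖ_ : Carrier → Carrier → Set ℓ
  k₁ ↦ₖ k₂ = InT k₁ × InT k₂ ×
    ((1# + k₁) * (1# + k₁) * (k₂ * k₂) ≈ (1# + 1# + 1# + 1#) * k₁)

  TAdv : ℕ → Carrier → Set (c ⊔ ℓ)
  TAdv zero    k = Level.Lift c (InT k)
  TAdv (suc n) k = InT k × ∃ λ k' → (k ↦ₖ k') × TAdv n k'

  TBack : ℕ → Carrier → Set (c ⊔ ℓ)
  TBack zero    k = Level.Lift c (InT k)
  TBack (suc n) k = InT k × ∃ λ k' → (k' ↦ₖ k) × TBack n k'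

  TAdv∞ : Carrier → Set (c ⊔ ℓ)
  TAdv∞ k = ∀ n → TAdv n k

  TBack∞ : Carrier → Set (c ⊔ ℓ)
  TBack∞ k = ∀ n → TBack n k

  Scaled : (Carrier → Set (c ⊔ ℓ)) → Carrier × Carrier → Set (c ⊔ ℓ)
  Scaled P (α , β) = ∃ λ a → ∃ λ k → ¬ (a ≈ 0#) × P k × (α ≈ a) × (β ≈ k * a)

  _≐_ : (Carrier × Carrier → Set (c ⊔ ℓ)) → (Carrier × Carrier → Set (c ⊔ ℓ)) → Set (c ⊔ ℓ)
  P ≐ Q = ∀ x → (P x → Q x) × (Q x → P x)

  K²-setoid : Setoid c ℓ
  K²-setoid = setoid ×ₛ setoid
    where open import Data.Product.Relation.Binary.Pointwise.NonDependent using (_×ₛ_)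

{-# OPTIONS --safe #-}
module Submission where

-- For α ≠ 0 write β = kα. Then (α, β) ∈ S_K iff k ∈ T_K and, writing also δ = k′γ, the
-- edge (α, β) ↦ (γ, δ) holds iff k ↦ k′ and 2γ = (1 + k)α: under this midpoint condition
-- 4δ² = (1 + k)²k′²α², so δ² = αβ becomes (1 + k)²k′² = 4k. The midpoint condition
-- determines γ from α and, as 1 + k′ ≠ 0, also α from γ; hence chains of ratios in T_K
-- lift to chains in S_K through any (a, ka), forwards and backwards, and chains in S_K
-- project to their chains of ratios.
-- Over a finite field the decidable sets T^adv_n decrease, so they stabilise, and once
-- T^adv_N ⊆ T^adv_{N+1} the chain is constant from N on. Thus T^adv_∞ is decidable and
-- can be counted, and (a, k) ↦ (a, ka) is a bijection K^× × T^adv_∞ → S^adv_∞.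

open import Defs
open import Level using (Lift; _⊔_; lift; lower)
open import Data.Bool.Properties using (T-≡)
open import Data.Nat as ℕ using (ℕ; zero; suc; _∸_; _%_; _≤_; z≤n; s≤s)
open import Data.Nat.Properties using (m≤m+n; n≤1+n)
open import Data.Fin using (Fin; zero; suc; punchIn; punchOut; combine; remQuot)
open import Data.Fin.Properties
  using (any?; suc-injective; punchIn-injective; punchInᵢ≢i; punchIn-punchOut;
         combine-remQuot; remQuot-combine)
  renaming (_≟_ to _≟ᶠ_)
open import Data.Fin.Subset using (Subset; _∈_; _⊂_) renaming (_⊆_ to _⊆ˢ_)
open import Data.Fin.Subset.Properties using (_∈?_)
open import Data.Fin.Subset.Induction using (⊂-wellFounded)
open import Data.Vec using (tabulate)
open import Data.Vec.Properties using (lookup∘tabulate; lookup⇒[]=; []=⇒lookup)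
open import Data.Product using (∃; _×_; _,_; proj₁; proj₂; uncurry)
import Data.Product as Product
open import Data.Product.Relation.Binary.Pointwise.NonDependent using (_×ₛ_)
open import Data.Unit using (⊤; tt)
open import Data.Empty using (⊥-elim)
open import Function using (_∘_; _$_; id)
open import Function.Bundles using (_⇔_; mk⇔; module Equivalence)
open import Induction.WellFounded using (Acc; acc)
open import Relation.Nullary using (¬_; Dec; yes; no; ¬?; _×-dec_)
open import Relation.Nullary.Decidable
  using (map′; isYes; decidable-stable; toWitness; fromWitness)
open import Relation.Unary using (Pred; Decidable; _⊆_)
open import Relation.Binary using (Setoid; _Respects_) renaming (Decidable to Decidable₂)
open import Relation.Binary.PropositionalEquality as ≡ using (_≡_)

open Equivalence using (to; from)

-- Finite sets

⊇-chain-stabilises : ∀ {n} (s : ℕ → Subset n) → (∀ k → s (suc k) ⊆ˢ s k) →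
                     ∃ λ N → s N ⊆ˢ s (suc N)
⊇-chain-stabilises s shrinks = go 0 (⊂-wellFounded (s 0))
  where
  go : ∀ k → Acc _⊂_ (s k) → ∃ λ N → s N ⊆ˢ s (suc N)
  go k (acc smaller) with any? (λ i → (i ∈? s k) ×-dec ¬? (i ∈? s (suc k)))
  ... | yes (i , i∈sₖ , i∉sₖ₊₁) = go (suc k) (smaller (shrinks k , i , i∈sₖ , i∉sₖ₊₁))
  ... | no none = k , λ {i} i∈sₖ →
    decidable-stable (i ∈? s (suc k)) (λ i∉sₖ₊₁ → none (i , i∈sₖ , i∉sₖ₊₁))

module _ {p n} {P : Pred (Fin n) p} (P? : Decidable P) where

  subset : Subset n
  subset = tabulate (isYes ∘ P?)

  ∈-subset⁺ : P ⊆ (_∈ subset)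
  ∈-subset⁺ {i} Pi =
    lookup⇒[]= i subset
      (≡.trans (lookup∘tabulate _ i) (to T-≡ (fromWitness {a? = P? i} Pi)))

  ∈-subset⁻ : (_∈ subset) ⊆ P
  ∈-subset⁻ {i} i∈ =
    toWitness (from T-≡ (≡.trans (≡.sym (lookup∘tabulate _ i)) ([]=⇒lookup i∈)))

Fin-HasCard : ∀ n → HasCard (≡.setoid (Fin n)) (λ _ → ⊤) n
Fin-HasCard n = id , _ , (λ _ _ → id) , (λ i _ → i , ≡.refl)

Fin×Fin-HasCard : ∀ m n → HasCard (≡.setoid (Fin m × Fin n)) (λ _ → ⊤) (m ℕ.* n)
Fin×Fin-HasCard m n =
  remQuot {m} n , _ , injective , λ (i , j) _ → combine i j , remQuot-combine i j
  where
  injective : ∀ i i′ → remQuot {m} n i ≡ remQuot n i′ → i ≡ i′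
  injective i i′ eq = ≡.trans (≡.sym (combine-remQuot {m} n i))
                       (≡.trans (≡.cong (uncurry combine) eq) (combine-remQuot {m} n i′))

Fin-filter : ∀ {p n} {P : Pred (Fin n) p} → Decidable P →
             ∃ λ m → HasCard (≡.setoid (Fin n)) P m
Fin-filter {n = zero} P? = 0 , (λ ()) , (λ ()) , (λ ()) , λ ()
Fin-filter {n = suc n} {P} P? with Fin-filter (P? ∘ suc) | P? zero
... | m , g , gP , g-inj , g-onto | no ¬P0 =
  m , suc ∘ g , gP , (λ i j → g-inj i j ∘ suc-injective) , onto
  where
  onto : ∀ i → P i → ∃ λ j → suc (g j) ≡ i
  onto zero    P0 = ⊥-elim (¬P0 P0)
  onto (suc i) Pi = Product.map₂ (≡.cong suc) (g-onto i Pi)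
... | m , g , gP , g-inj , g-onto | yes P0 = suc m , g′ , g′P , g′-inj , g′-onto
  where
  g′ : Fin (suc m) → Fin (suc n)
  g′ zero    = zero
  g′ (suc j) = suc (g j)
  g′P : ∀ j → P (g′ j)
  g′P zero    = P0
  g′P (suc j) = gP j
  g′-inj : ∀ j j′ → g′ j ≡ g′ j′ → j ≡ j′
  g′-inj zero    zero     _  = ≡.refl
  g′-inj (suc j) (suc j′) eq = ≡.cong suc (g-inj j j′ (suc-injective eq))
  g′-onto : ∀ i → P i → ∃ λ j → g′ j ≡ i
  g′-onto zero    _  = zero , ≡.refl
  g′-onto (suc i) Pi = Product.map suc (≡.cong suc) (g-onto i Pi)

HasCard-image : ∀ {a b ℓa ℓb p q m} (A : Setoid a ℓa) (B : Setoid b ℓb)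
  {P : Pred (Setoid.Carrier A) p} {Q : Pred (Setoid.Carrier B) q}
  (h : Setoid.Carrier A → Setoid.Carrier B) →
  (∀ {x y} → Setoid._≈_ A x y → Setoid._≈_ B (h x) (h y)) →
  (∀ {x y} → P x → P y → Setoid._≈_ B (h x) (h y) → Setoid._≈_ A x y) →
  (∀ {x} → P x → Q (h x)) →
  (∀ {y} → Q y → ∃ λ x → P x × Setoid._≈_ B (h x) y) →
  HasCard A P m → HasCard B Q m
HasCard-image A B h h-cong h-inj h-maps h-onto (f , fP , f-inj , f-onto) =
  h ∘ f , h-maps ∘ fP , (λ i j → f-inj i j ∘ h-inj (fP i) (fP j)) , onto
  where
  onto : ∀ y → _ → ∃ λ i → Setoid._≈_ B (h (f i)) y
  onto y Qy = let x , Px , hx≈y = h-onto Qy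
                  i , fi≈x      = f-onto x Px
              in i , Setoid.trans B (h-cong fi≈x) hx≈y

module _ {a b ℓa ℓb} (A : Setoid a ℓa) (B : Setoid b ℓb) where
  private
    module A = Setoid A
    module B = Setoid B

  HasCard-× : ∀ {p q m n} {P : Pred A.Carrier p} {Q : Pred B.Carrier q} →
    HasCard A P m → HasCard B Q n →
    HasCard (A ×ₛ B) (λ xy → P (proj₁ xy) × Q (proj₂ xy)) (m ℕ.* n)
  HasCard-× {m = m} {n} (f , fP , f-inj , f-onto) (g , gQ , g-inj , g-onto) =
    HasCard-image (≡.setoid (Fin m × Fin n)) (A ×ₛ B) (Product.map f g)
      (λ { ≡.refl → A.refl , B.refl })
      (λ {(i , j)} {(i′ , j′)} _ _ (fi≈fi′ , gj≈gj′) →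
         ≡.cong₂ _,_ (f-inj i i′ fi≈fi′) (g-inj j j′ gj≈gj′))
      (λ {(i , j)} _ → fP i , gQ j)
      (λ {(x , y)} (Px , Qy) → let i , fi≈x = f-onto x Px
                                   j , gj≈y = g-onto y Qy
                               in (i , j) , _ , fi≈x , gj≈y)
      (Fin×Fin-HasCard m n)

module _ {a ℓ} (A : Setoid a ℓ) where
  open Setoid A

  finite⇒≈-decidable : ∀ {n} → HasCard A (λ _ → ⊤) n → Decidable₂ _≈_
  finite⇒≈-decidable (f , _ , f-inj , f-onto) x y
    with f-onto x tt | f-onto y tt
  ... | i , fi≈x | j , fj≈y = map′
    (λ i≡j → trans (sym fi≈x) (trans (reflexive (≡.cong f i≡j)) fj≈y))
    (λ x≈y → f-inj i j (trans fi≈x (trans x≈y (sym fj≈y))))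
    (i ≟ᶠ j)

  finite⇒∃-decidable : ∀ {n p} {P : Pred Carrier p} → HasCard A (λ _ → ⊤) n →
                       P Respects _≈_ → Decidable P → Dec (∃ P)
  finite⇒∃-decidable (f , _ , _ , f-onto) P-resp P? = map′
    (λ (i , Pfi) → f i , Pfi)
    (λ (x , Px) → let i , fi≈x = f-onto x tt in i , P-resp (sym fi≈x) Px)
    (any? (P? ∘ f))

  HasCard-filter : ∀ {n p} {P : Pred Carrier p} → HasCard A (λ _ → ⊤) n →
                   P Respects _≈_ → Decidable P → ∃ λ m → HasCard A P m
  HasCard-filter (f , _ , f-inj , f-onto) P-resp P? =
    let m , Fin-card = Fin-filter (P? ∘ f) in
    m , HasCard-image (≡.setoid (Fin _)) A f (reflexive ∘ ≡.cong f)
          (λ _ _ → f-inj _ _) id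
          (λ {x} Px → let i , fi≈x = f-onto x tt in i , P-resp (sym fi≈x) Px , fi≈x)
          Fin-card

  HasCard-remove : ∀ {n} → HasCard A (λ _ → ⊤) (suc n) → ∀ a → HasCard A (λ x → ¬ x ≈ a) n
  HasCard-remove {n} (f , _ , f-inj , f-onto) a =
    HasCard-image (≡.setoid (Fin n)) A (f ∘ punchIn i₀)
      (reflexive ∘ ≡.cong (f ∘ punchIn i₀))
      (λ _ _ → punchIn-injective i₀ _ _ ∘ f-inj _ _)
      (λ {j} _ fj≈a → punchInᵢ≢i i₀ j (f-inj _ _ (trans fj≈a (sym fi₀≈a))))
      onto
      (Fin-HasCard n)
    where
    i₀ = proj₁ (f-onto a tt)
    fi₀≈a = proj₂ (f-onto a tt)
    onto : ∀ {x} → ¬ x ≈ a → ∃ λ j → ⊤ × f (punchIn i₀ j) ≈ x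
    onto {x} x≉a =
      punchOut i₀≢i , _ , trans (reflexive (≡.cong f (punchIn-punchOut i₀≢i))) fi≈x
      where
      i = proj₁ (f-onto x tt)
      fi≈x = proj₂ (f-onto x tt)
      i₀≢i : ¬ i₀ ≡ i
      i₀≢i i₀≡i =
        x≉a (trans (sym fi≈x) (trans (reflexive (≡.cong f (≡.sym i₀≡i))) fi₀≈a))

  finite-chain-stabilises : ∀ {n p} → HasCard A (λ _ → ⊤) n →
    (P : ℕ → Pred Carrier p) → (∀ k → P k Respects _≈_) → (∀ k → Decidable (P k)) →
    (∀ k → P (suc k) ⊆ P k) → ∃ λ N → P N ⊆ P (suc N)
  finite-chain-stabilises (f , _ , _ , f-onto) P P-resp P? shrinks =
    let N , sN⊆sN+1 = ⊇-chain-stabilises s (λ k → ∈-subset⁺ _ ∘ shrinks k ∘ ∈-subset⁻ _)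
    in N , λ {x} PNx → let i , fi≈x = f-onto x tt in
      P-resp (suc N) fi≈x (∈-subset⁻ _ (sN⊆sN+1 (∈-subset⁺ _ (P-resp N (sym fi≈x) PNx))))
    where
    s : ℕ → Subset _
    s k = subset (P? k ∘ f)

-- Chains in S_K and T_K

∀-⇔ : ∀ {a b c} {I : Set a} {A : I → Set b} {B : I → Set c} →
      (∀ i → A i ⇔ B i) → (∀ i → A i) ⇔ (∀ i → B i)
∀-⇔ A⇔B = mk⇔ (λ f i → to (A⇔B i) (f i)) (λ g i → from (A⇔B i) (g i))

Lift-⇔ : ∀ {a b ℓ} {A : Set a} {B : Set b} → A ⇔ B → Lift ℓ A ⇔ Lift ℓ B
Lift-⇔ A⇔B = mk⇔ (lift ∘ to A⇔B ∘ lower) (lift ∘ from A⇔B ∘ lower)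

module FieldProperties {c ℓ} (K : Field c ℓ) where
  open FieldDefs K
  open import Algebra.Properties.Ring ring
    using (-‿distribˡ-*; +-inverseʳ-unique; x∙y⁻¹≈ε⇒x≈y)
  open import Relation.Binary.Reasoning.Setoid setoid

  divide : ∀ {a} → ¬ a ≈ 0# → ∀ b → ∃ λ x → a * x ≈ b
  divide {a} a≉0 b = let u , au≈1 = inverse a a≉0 in u * b , (begin
    a * (u * b) ≈⟨ *-assoc a u b ⟨
    a * u * b   ≈⟨ *-congʳ au≈1 ⟩
    1# * b      ≈⟨ *-identityˡ b ⟩
    b           ∎)

  ratio : ∀ {α} → ¬ α ≈ 0# → ∀ β → ∃ λ k → β ≈ k * α
  ratio {α} α≉0 β = let k , αk≈β = divide α≉0 β in k , trans (sym αk≈β) (*-comm α k)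

  *-cancelʳ-≉0 : ∀ {a x y} → ¬ a ≈ 0# → x * a ≈ y * a → x ≈ y
  *-cancelʳ-≉0 {a} {x} {y} a≉0 xa≈ya = let u , au≈1 = inverse a a≉0 in begin
    x            ≈⟨ *-identityʳ x ⟨
    x * 1#       ≈⟨ *-congˡ au≈1 ⟨
    x * (a * u)  ≈⟨ *-assoc x a u ⟨
    x * a * u    ≈⟨ *-congʳ xa≈ya ⟩
    y * a * u    ≈⟨ *-assoc y a u ⟩
    y * (a * u)  ≈⟨ *-congˡ au≈1 ⟩
    y * 1#       ≈⟨ *-identityʳ y ⟩
    y            ∎

  *-cancelˡ-≉0 : ∀ {a x y} → ¬ a ≈ 0# → a * x ≈ a * y → x ≈ y
  *-cancelˡ-≉0 {a} {x} {y} a≉0 ax≈ay =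
    *-cancelʳ-≉0 a≉0 (trans (*-comm x a) (trans ax≈ay (*-comm a y)))

  *-≉0 : ∀ {x y} → ¬ x ≈ 0# → ¬ y ≈ 0# → ¬ x * y ≈ 0#
  *-≉0 {x} {y} x≉0 y≉0 xy≈0 = x≉0 (*-cancelʳ-≉0 y≉0 (trans xy≈0 (sym (zeroˡ y))))

  ≉0-factorʳ : ∀ {x y z} → x * y ≈ z → ¬ z ≈ 0# → ¬ y ≈ 0#
  ≉0-factorʳ {x} xy≈z z≉0 y≈0 = z≉0 (trans (sym xy≈z) (trans (*-congˡ y≈0) (zeroʳ x)))

  1+x≉0 : ∀ {x} → ¬ x ≈ - 1# → ¬ 1# + x ≈ 0#
  1+x≉0 {x} x≉-1 = x≉-1 ∘ +-inverseʳ-unique 1# x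

  1-x≉0 : ∀ {x} → ¬ x ≈ 1# → ¬ 1# - x ≈ 0#
  1-x≉0 {x} x≉1 = x≉1 ∘ sym ∘ x∙y⁻¹≈ε⇒x≈y 1# x

  InT⇒1+k≉0 : ∀ {k} → InT k → ¬ 1# + k ≈ 0#
  InT⇒1+k≉0 (_ , _ , k≉-1) = 1+x≉0 k≉-1

  x≈-1⇒1+x≈0 : ∀ {x} → x ≈ - 1# → 1# + x ≈ 0#
  x≈-1⇒1+x≈0 x≈-1 = trans (+-congˡ x≈-1) (-‿inverseʳ 1#)

  x≈1⇒1-x≈0 : ∀ {x} → x ≈ 1# → 1# - x ≈ 0#
  x≈1⇒1-x≈0 x≈1 = trans (+-congˡ (-‿cong x≈1)) (-‿inverseʳ 1#)

  α+β≈[1+k]α : ∀ {α β k} → β ≈ k * α → α + β ≈ (1# + k) * α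
  α+β≈[1+k]α {α} {β} {k} β≈kα =
    trans (+-cong (sym (*-identityˡ α)) β≈kα) (sym (distribʳ α 1# k))

  α-β≈[1-k]α : ∀ {α β k} → β ≈ k * α → α - β ≈ (1# - k) * α
  α-β≈[1-k]α {α} {β} {k} β≈kα =
    trans (+-cong (sym (*-identityˡ α)) (trans (-‿cong β≈kα) (-‿distribˡ-* k α)))
          (sym (distribʳ α 1# (- k)))

  InS⇔InT : ∀ {α β k} → ¬ α ≈ 0# → β ≈ k * α → InS α β ⇔ InT k
  InS⇔InT {α} {β} {k} α≉0 β≈kα = mk⇔
    (λ (_ , β≉0 , α+β≉0 , α-β≉0) →
       β≉0 ∘ vanishes β≈kα ,
       α-β≉0 ∘ vanishes (α-β≈[1-k]α β≈kα) ∘ x≈1⇒1-x≈0 ,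
       α+β≉0 ∘ vanishes (α+β≈[1+k]α β≈kα) ∘ x≈-1⇒1+x≈0)
    (λ (k≉0 , k≉1 , k≉-1) →
       α≉0 ,
       survives β≈kα k≉0 ,
       survives (α+β≈[1+k]α β≈kα) (1+x≉0 k≉-1) ,
       survives (α-β≈[1-k]α β≈kα) (1-x≉0 k≉1))
    where
    vanishes : ∀ {x y} → y ≈ x * α → x ≈ 0# → y ≈ 0#
    vanishes y≈xα x≈0 = trans y≈xα (trans (*-congʳ x≈0) (zeroˡ α))
    survives : ∀ {x y} → y ≈ x * α → ¬ x ≈ 0# → ¬ y ≈ 0#
    survives y≈xα x≉0 y≈0 = *-≉0 x≉0 α≉0 (trans (sym y≈xα) y≈0)

  ≐-Scaled : ∀ {S : Pred (Carrier × Carrier) (c ⊔ ℓ)} {T : Pred Carrier (c ⊔ ℓ)} →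
    (∀ {α β} → S (α , β) → ¬ α ≈ 0#) →
    (∀ {α β k} → ¬ α ≈ 0# → β ≈ k * α → S (α , β) ⇔ T k) →
    S ≐ Scaled T
  ≐-Scaled S⇒α≉0 S⇔T (α , β) =
    (λ Sαβ → let α≉0 = S⇒α≉0 Sαβ
                 k , β≈kα = ratio α≉0 β
             in α , k , α≉0 , to (S⇔T α≉0 β≈kα) Sαβ , refl , β≈kα) ,
    (λ (a , k , a≉0 , Tk , α≈a , β≈ka) →
       from (S⇔T (a≉0 ∘ trans (sym α≈a)) (trans β≈ka (*-congˡ (sym α≈a)))) Tk)

  HasCard-Scaled : ∀ {S T u m} → S ≐ Scaled T →
    HasCard setoid (λ a → ¬ a ≈ 0#) u → HasCard setoid T m → HasCard K²-setoid S (u ℕ.* m)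
  HasCard-Scaled {S} {T} S≐ units Tcard =
    HasCard-image (setoid ×ₛ setoid) K²-setoid (λ (a , k) → a , k * a)
      (λ (a≈a′ , k≈k′) → a≈a′ , *-cong k≈k′ a≈a′)
      (λ (a≉0 , _) _ (a≈a′ , ka≈k′a′) →
         a≈a′ , *-cancelʳ-≉0 a≉0 (trans ka≈k′a′ (*-congˡ (sym a≈a′))))
      (λ {(a , k)} (a≉0 , Tk) → proj₂ (S≐ (a , k * a)) (a , k , a≉0 , Tk , refl , refl))
      (λ {(α , β)} Sαβ → let a , k , a≉0 , Tk , α≈a , β≈ka = proj₁ (S≐ (α , β)) Sαβ
                         in (a , k) , (a≉0 , Tk) , sym α≈a , sym β≈ka)
      (HasCard-× setoid setoid units Tcard)

  units-HasCard : ∀ {q} → HasCard setoid (λ _ → ⊤) q →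
                  HasCard setoid (λ a → ¬ a ≈ 0#) (q ∸ 1)
  units-HasCard {zero}  (_ , _ , _ , onto) with () ← proj₁ (onto 0# tt)
  units-HasCard {suc q} K-finite = HasCard-remove setoid K-finite 0#

module ScaledChains {c ℓ} (K : Field c ℓ) (char≢2 : FieldDefs.CharNot2 K) where
  open FieldDefs K
  open FieldProperties K
  open import Algebra.Solver.Ring.NaturalCoefficients.Default commutativeSemiring
  open import Relation.Binary.Reasoning.Setoid setoid

  two four : Carrier
  two  = 1# + 1#
  four = 1# + 1# + 1# + 1#

  four≉0 : ¬ four ≈ 0#
  four≉0 = *-≉0 char≢2 char≢2 ∘ trans
    (solve 0 ((con 1 :+ con 1) :* (con 1 :+ con 1) := con 1 :+ con 1 :+ con 1 :+ con 1) refl)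

  four*δ²≈[1+k]²k′²α² : ∀ {α γ δ k k′} → δ ≈ k′ * γ → two * γ ≈ (1# + k) * α →
                        four * (δ * δ) ≈ (1# + k) * (1# + k) * (k′ * k′) * (α * α)
  four*δ²≈[1+k]²k′²α² {α} {γ} {δ} {k} {k′} δ≈k′γ 2γ≈[1+k]α = begin
    four * (δ * δ)
      ≈⟨ *-congˡ (*-cong δ≈k′γ δ≈k′γ) ⟩
    four * (k′ * γ * (k′ * γ))
      ≈⟨ solve 2 (λ k′ γ →
           (con 1 :+ con 1 :+ con 1 :+ con 1) :* (k′ :* γ :* (k′ :* γ))
             := k′ :* ((con 1 :+ con 1) :* γ) :* (k′ :* ((con 1 :+ con 1) :* γ)))
           refl k′ γ ⟩
    k′ * (two * γ) * (k′ * (two * γ))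
      ≈⟨ *-cong (*-congˡ 2γ≈[1+k]α) (*-congˡ 2γ≈[1+k]α) ⟩
    k′ * ((1# + k) * α) * (k′ * ((1# + k) * α))
      ≈⟨ solve 3 (λ k′ k α →
           k′ :* ((con 1 :+ k) :* α) :* (k′ :* ((con 1 :+ k) :* α))
             := (con 1 :+ k) :* (con 1 :+ k) :* (k′ :* k′) :* (α :* α))
           refl k′ k α ⟩
    (1# + k) * (1# + k) * (k′ * k′) * (α * α) ∎

  four*αβ≈four*k*α² : ∀ {α β k} → β ≈ k * α → four * (α * β) ≈ four * k * (α * α)
  four*αβ≈four*k*α² {α} {β} {k} β≈kα = begin
    four * (α * β)
      ≈⟨ *-congˡ (*-congˡ β≈kα) ⟩
    four * (α * (k * α))
      ≈⟨ solve 2 (λ k α →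
           (con 1 :+ con 1 :+ con 1 :+ con 1) :* (α :* (k :* α))
             := (con 1 :+ con 1 :+ con 1 :+ con 1) :* k :* (α :* α))
           refl k α ⟩
    four * k * (α * α)
      ∎

  2γ≈[1+k]α⇒γ≉0 : ∀ {α γ k} → InT k → ¬ α ≈ 0# → two * γ ≈ (1# + k) * α → ¬ γ ≈ 0#
  2γ≈[1+k]α⇒γ≉0 k∈T α≉0 2γ≈[1+k]α = ≉0-factorʳ 2γ≈[1+k]α (*-≉0 (InT⇒1+k≉0 k∈T) α≉0)

  ↦⇔↦ₖ : ∀ {α β γ δ k k′} → ¬ α ≈ 0# → β ≈ k * α → δ ≈ k′ * γ →
         ((α , β) ↦ (γ , δ)) ⇔ ((k ↦ₖ k′) × two * γ ≈ (1# + k) * α)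
  ↦⇔↦ₖ {α} {β} {γ} {δ} {k} {k′} α≉0 β≈kα δ≈k′γ = mk⇔ ltr rtl
    where
    ltr : (α , β) ↦ (γ , δ) → (k ↦ₖ k′) × two * γ ≈ (1# + k) * α
    ltr (αβ∈S , γδ∈S , 2γ≈α+β , δ²≈αβ) =
      (to (InS⇔InT α≉0 β≈kα) αβ∈S , to (InS⇔InT (proj₁ γδ∈S) δ≈k′γ) γδ∈S ,
       *-cancelʳ-≉0 (*-≉0 α≉0 α≉0) (begin
         (1# + k) * (1# + k) * (k′ * k′) * (α * α)
           ≈⟨ four*δ²≈[1+k]²k′²α² δ≈k′γ 2γ≈[1+k]α ⟨
         four * (δ * δ)     ≈⟨ *-congˡ δ²≈αβ ⟩
         four * (α * β)     ≈⟨ four*αβ≈four*k*α² β≈kα ⟩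
         four * k * (α * α) ∎)) ,
      2γ≈[1+k]α
      where
      2γ≈[1+k]α = trans 2γ≈α+β (α+β≈[1+k]α β≈kα)
    rtl : (k ↦ₖ k′) × two * γ ≈ (1# + k) * α → (α , β) ↦ (γ , δ)
    rtl ((k∈T , k′∈T , [1+k]²k′²≈4k) , 2γ≈[1+k]α) =
      from (InS⇔InT α≉0 β≈kα) k∈T , from (InS⇔InT γ≉0 δ≈k′γ) k′∈T ,
      trans 2γ≈[1+k]α (sym (α+β≈[1+k]α β≈kα)) ,
      *-cancelˡ-≉0 four≉0 (begin
        four * (δ * δ)
          ≈⟨ four*δ²≈[1+k]²k′²α² δ≈k′γ 2γ≈[1+k]α ⟩
        (1# + k) * (1# + k) * (k′ * k′) * (α * α)
          ≈⟨ *-congʳ [1+k]²k′²≈4k ⟩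
        four * k * (α * α)
          ≈⟨ four*αβ≈four*k*α² β≈kα ⟨
        four * (α * β)
          ∎)
      where
      γ≉0 = 2γ≈[1+k]α⇒γ≉0 k∈T α≉0 2γ≈[1+k]α

  SAdv⇔TAdv : ∀ n {α β k} → ¬ α ≈ 0# → β ≈ k * α → SAdv n (α , β) ⇔ TAdv n k
  SAdv⇔TAdv zero α≉0 β≈kα = Lift-⇔ (InS⇔InT α≉0 β≈kα)
  SAdv⇔TAdv (suc n) {α} {β} {k} α≉0 β≈kα = mk⇔ ltr rtl
    where
    ltr : SAdv (suc n) (α , β) → TAdv (suc n) k
    ltr (αβ∈S , (γ , δ) , edge , chain) =
      let γ≉0 = proj₁ (proj₁ (proj₂ edge))
          k′ , δ≈k′γ = ratio γ≉0 δ
      in to (InS⇔InT α≉0 β≈kα) αβ∈S , k′ ,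
         proj₁ (to (↦⇔↦ₖ α≉0 β≈kα δ≈k′γ) edge) ,
         to (SAdv⇔TAdv n γ≉0 δ≈k′γ) chain
    rtl : TAdv (suc n) k → SAdv (suc n) (α , β)
    rtl (k∈T , k′ , k↦k′ , chain) =
      let γ , 2γ≈[1+k]α = divide char≢2 ((1# + k) * α)
          γ≉0 = 2γ≈[1+k]α⇒γ≉0 k∈T α≉0 2γ≈[1+k]α
      in from (InS⇔InT α≉0 β≈kα) k∈T , (γ , k′ * γ) ,
         from (↦⇔↦ₖ α≉0 β≈kα refl) (k↦k′ , 2γ≈[1+k]α) ,
         from (SAdv⇔TAdv n γ≉0 refl) chain

  SBack⇔TBack : ∀ n {α β k} → ¬ α ≈ 0# → β ≈ k * α → SBack n (α , β) ⇔ TBack n k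
  SBack⇔TBack zero α≉0 β≈kα = Lift-⇔ (InS⇔InT α≉0 β≈kα)
  SBack⇔TBack (suc n) {α} {β} {k} α≉0 β≈kα = mk⇔ ltr rtl
    where
    ltr : SBack (suc n) (α , β) → TBack (suc n) k
    ltr (αβ∈S , (α′ , β′) , edge , chain) =
      let α′≉0 = proj₁ (proj₁ edge)
          k′ , β′≈k′α′ = ratio α′≉0 β′
      in to (InS⇔InT α≉0 β≈kα) αβ∈S , k′ ,
         proj₁ (to (↦⇔↦ₖ α′≉0 β′≈k′α′ β≈kα) edge) ,
         to (SBack⇔TBack n α′≉0 β′≈k′α′) chain
    rtl : TBack (suc n) k → SBack (suc n) (α , β)
    rtl (k∈T , k′ , k′↦k , chain) =
      let α′ , [1+k′]α′≈2α = divide (InT⇒1+k≉0 (proj₁ k′↦k)) (two * α)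
          α′≉0 = ≉0-factorʳ [1+k′]α′≈2α (*-≉0 char≢2 α≉0)
      in from (InS⇔InT α≉0 β≈kα) k∈T , (α′ , k′ * α′) ,
         from (↦⇔↦ₖ α′≉0 refl β≈kα) (k′↦k , sym [1+k′]α′≈2α) ,
         from (SBack⇔TBack n α′≉0 refl) chain

  SAdv⇒InS : ∀ n {α β} → SAdv n (α , β) → InS α β
  SAdv⇒InS zero    = lower
  SAdv⇒InS (suc n) = proj₁

  SBack⇒InS : ∀ n {α β} → SBack n (α , β) → InS α β
  SBack⇒InS zero    = lower
  SBack⇒InS (suc n) = proj₁

  SAdv≐Scaled-TAdv : ∀ n → SAdv n ≐ Scaled (TAdv n)
  SAdv≐Scaled-TAdv n = ≐-Scaled (proj₁ ∘ SAdv⇒InS n) (SAdv⇔TAdv n)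

  SAdv∞≐Scaled-TAdv∞ : SAdv∞ ≐ Scaled TAdv∞
  SAdv∞≐Scaled-TAdv∞ =
    ≐-Scaled (λ S → proj₁ (SAdv⇒InS 0 (S 0)))
             (λ α≉0 β≈kα → ∀-⇔ λ n → SAdv⇔TAdv n α≉0 β≈kα)

  SBack≐Scaled-TBack : ∀ n → SBack n ≐ Scaled (TBack n)
  SBack≐Scaled-TBack n = ≐-Scaled (proj₁ ∘ SBack⇒InS n) (SBack⇔TBack n)

  SBack∞≐Scaled-TBack∞ : SBack∞ ≐ Scaled TBack∞
  SBack∞≐Scaled-TBack∞ =
    ≐-Scaled (λ S → proj₁ (SBack⇒InS 0 (S 0)))
             (λ α≉0 β≈kα → ∀-⇔ λ n → SBack⇔TBack n α≉0 β≈kα)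

module TAdvProperties {c ℓ} (K : Field c ℓ) where
  open FieldDefs K

  InT-resp : InT Respects _≈_
  InT-resp x≈y (x≉0 , x≉1 , x≉-1) = x≉0 ∘ trans x≈y , x≉1 ∘ trans x≈y , x≉-1 ∘ trans x≈y

  ↦ₖ-respˡ : ∀ {k′} → (_↦ₖ k′) Respects _≈_
  ↦ₖ-respˡ x≈y (x∈T , k′∈T , [1+x]²k′²≈4x) =
    InT-resp x≈y x∈T , k′∈T ,
    trans (*-congʳ (*-cong (+-congˡ (sym x≈y)) (+-congˡ (sym x≈y))))
          (trans [1+x]²k′²≈4x (*-congˡ x≈y))

  ↦ₖ-respʳ : ∀ {k} → (k ↦ₖ_) Respects _≈_
  ↦ₖ-respʳ x≈y (k∈T , x∈T , [1+k]²x²≈4k) =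
    k∈T , InT-resp x≈y x∈T , trans (*-congˡ (*-cong (sym x≈y) (sym x≈y))) [1+k]²x²≈4k

  TAdv-resp : ∀ n → TAdv n Respects _≈_
  TAdv-resp zero    x≈y = lift ∘ InT-resp x≈y ∘ lower
  TAdv-resp (suc n) x≈y (x∈T , k′ , x↦k′ , chain) =
    InT-resp x≈y x∈T , k′ , ↦ₖ-respˡ x≈y x↦k′ , chain

  TAdv⇒InT : ∀ n → TAdv n ⊆ InT
  TAdv⇒InT zero    = lower
  TAdv⇒InT (suc n) = proj₁

  TAdv-antitone : ∀ {m n} → m ≤ n → TAdv n ⊆ TAdv m
  TAdv-antitone {n = n} z≤n   = lift ∘ TAdv⇒InT n
  TAdv-antitone (s≤s m≤n) (k∈T , k′ , k↦k′ , chain) =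
    k∈T , k′ , k↦k′ , TAdv-antitone m≤n chain

  TAdv-stable-suc : ∀ {n} → TAdv n ⊆ TAdv (suc n) → TAdv (suc n) ⊆ TAdv (suc (suc n))
  TAdv-stable-suc stable (k∈T , k′ , k↦k′ , chain) = k∈T , k′ , k↦k′ , stable chain

  TAdv-stable⇒TAdv∞ : ∀ {N} → TAdv N ⊆ TAdv (suc N) → TAdv N ⊆ TAdv∞
  TAdv-stable⇒TAdv∞ {N} stable t n = TAdv-antitone (m≤m+n n N) (reach n t)
    where
    stable-from : ∀ m → TAdv (m ℕ.+ N) ⊆ TAdv (suc (m ℕ.+ N))
    stable-from zero    = stable
    stable-from (suc m) = TAdv-stable-suc (stable-from m)
    reach : ∀ m → TAdv N ⊆ TAdv (m ℕ.+ N)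
    reach zero    t = t
    reach (suc m) t = stable-from m (reach m t)

-- Finite fields

module FiniteField {c ℓ} (K : Field c ℓ) {q}
                   (K-finite : HasCard (FieldDefs.setoid K) (λ _ → ⊤) q) where
  open FieldDefs K
  open TAdvProperties K

  infix 4 _≈?_
  _≈?_ : Decidable₂ _≈_
  _≈?_ = finite⇒≈-decidable setoid K-finite

  InT? : Decidable InT
  InT? k = ¬? (k ≈? 0#) ×-dec ¬? (k ≈? 1#) ×-dec ¬? (k ≈? - 1#)

  TAdv? : ∀ n → Decidable (TAdv n)
  TAdv? zero    k = map′ lift lower (InT? k)
  TAdv? (suc n) k = InT? k ×-dec finite⇒∃-decidable setoid K-finite
    (λ x≈y → Product.map (↦ₖ-respʳ x≈y) (TAdv-resp n x≈y))
    (λ k′ → (InT? k ×-dec InT? k′ ×-dec (_ ≈? _)) ×-dec TAdv? n k′)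

  TAdv-stabilises : ∃ λ N → TAdv N ⊆ TAdv (suc N)
  TAdv-stabilises = finite-chain-stabilises setoid K-finite TAdv TAdv-resp TAdv?
    (λ n → TAdv-antitone (n≤1+n n))

  TAdv∞? : Decidable TAdv∞
  TAdv∞? k = let N , stable = TAdv-stabilises in
    map′ (TAdv-stable⇒TAdv∞ stable) (_$ N) (TAdv? N k)

  TAdv∞-HasCard : ∃ λ m → HasCard setoid TAdv∞ m
  TAdv∞-HasCard = HasCard-filter setoid K-finite (λ x≈y t n → TAdv-resp n x≈y (t n)) TAdv∞?

corollary3p2 : ∀ {c ℓ} (K : Field c ℓ) → let open FieldDefs K in
    CharNot2 →
    ((∀ n → SAdv n ≐ Scaled (TAdv n)) ×
     (SAdv∞ ≐ Scaled TAdv∞) ×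
     (∀ n → SBack n ≐ Scaled (TBack n)) ×
     (SBack∞ ≐ Scaled TBack∞)) ×
    (∀ q → q % 2 ≡ 1 → HasCard setoid (λ _ → ⊤) q →
      ∃ λ m → HasCard setoid TAdv∞ m × HasCard K²-setoid SAdv∞ ((q ∸ 1) ℕ.* m))
corollary3p2 K char≢2 =
  (SAdv≐Scaled-TAdv , SAdv∞≐Scaled-TAdv∞ , SBack≐Scaled-TBack , SBack∞≐Scaled-TBack∞) ,
  λ q _ K-finite →
    let m , TAdv∞-card = FiniteField.TAdv∞-HasCard K K-finite in
    m , TAdv∞-card , HasCard-Scaled SAdv∞≐Scaled-TAdv∞ (units-HasCard K-finite) TAdv∞-card
  where
  open FieldProperties K
  open ScaledChains K char≢2
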